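{- Let $n,r$ be positive integers, $G_r=2^r+1$, and $a,s\in\{1,\dots,2^n-2\}$ with binary expansions $a=\sum_{i=0}^{n-1}a_i2^i$ and $s=\sum_{i=0}^{n-1}s_i2^i$. The following are equivalent: (a) $s\equiv G_r\cdot a\pmod{2^n-1}$; (b) there exists a sequence $(c_{n-1},\dots,c_0)$ with $c_i\in\{0,1\}$ such that $2c_i-c_{i-1}+s_i=a_{i-r}+a_i$ for all $i$, where indices are taken modulo $n$. Moreover, the sequence $c$ in (b) is unique. -}

module Defs where

open import Data.Nat using (ℕ; zero; suc; NonZero; _+_; _*_; _∸_; _^_; _/_; _%_)
open import Data.Nat.DivMod using (_mod_)
open import Data.Fin using (Fin; toℕ)
open import Data.Integer as ℤ using (ℤ; +_)
import Data.Integer.Divisibility as ℤDiv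
open import Relation.Binary.PropositionalEquality using (_≡_)

G : ℕ → ℕ
G r = 2 ^ r + 1

bit : ℕ → ℕ → ℕ
bit a zero = a % 2
bit a (suc i) = bit (a / 2) i

-- index arithmetic modulo n (n positive): (i - k) mod n, as an element of Fin n
subMod : (n : ℕ) → .{{_ : NonZero n}} → Fin n → ℕ → Fin n
subMod n i k = (toℕ i + (n ∸ (k % n))) mod n

_≡_[mod_] : ℕ → ℕ → ℕ → Set
x ≡ y [mod m ] = (+ m) ℤDiv.∣ ((+ x) ℤ.- (+ y))

CarryEq : (n r a s : ℕ) → .{{_ : NonZero n}} → (Fin n → Fin 2) → Set
CarryEq n r a s c =
  ∀ (i : Fin n) →
    (+ 2) ℤ.* (+ toℕ (c i)) ℤ.- (+ toℕ (c (subMod n i 1))) ℤ.+ (+ bit s (toℕ i))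
      ≡ (+ bit a (toℕ (subMod n i r))) ℤ.+ (+ bit a (toℕ i))

module Submission where

-- Doubling a residue modulo 2^n - 1 rotates its n binary digits cyclically, so G_r a ≡ a + b
-- where b is a rotated by r places.  As a, s < 2^n - 1 and b < 2^n, condition (a) says exactly
-- that a + b + e = s + e 2^n for an end-around carry e ∈ {0,1}.  Running the carry chain of this
-- addition with carry-in e, the carry out of the top digit is e again, so the carries close up
-- into a cyclic sequence satisfying (b); conversely, summing the equations of (b) with weights 2^i
-- telescopes back to the end-around addition.  Each equation fixes 2c_i - c_{i-1}, hence c_i.

open import Defs
open import Data.Empty using (⊥-elim)
open import Data.Fin using (Fin; toℕ; fromℕ<; zero; suc)
open import Data.Fin.Properties using (toℕ-fromℕ<; toℕ-injective; toℕ<n)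
import Data.Integer as ℤ
open import Data.Integer.Properties
  using (m-n≡m⊖n; ∣⊖∣-≤; ∣m⊖n∣≡∣n⊖m∣; pos-+; pos-*; +-injective; +-0-abelianGroup)
open import Algebra.Properties.AbelianGroup +-0-abelianGroup using (∙-cancelʳ)
open import Data.Integer.Tactic.RingSolver renaming (solve-∀ to ℤsolve-∀)
open import Data.Nat
  using (ℕ; NonZero; zero; suc; _+_; _*_; _∸_; _^_; _%_; _/_; _≤_; _<_; z≤n; s≤s; z<s; s<s; s≤s⁻¹; >-nonZero)
open import Data.Nat.DivMod
  using (_mod_; m≡m%n+[m/n]*n; m%n<n; [m+n]%n≡m%n; [m+kn]%n≡m%n; m<n⇒m%n≡m; m<n*o⇒m/o<n)
open import Data.Nat.Divisibility using (_∣_; divides)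
open import Data.Nat.Properties
open import Data.Nat.Tactic.RingSolver using (solve-∀)
open import Data.Product using (_×_; _,_; ∃; proj₁; proj₂)
open import Data.Sum using (inj₁; inj₂)
open import Function.Base using (_∘_)
open import Function.Bundles using (_⇔_; mk⇔; Equivalence)
open import Relation.Binary.PropositionalEquality
  using (_≡_; refl; sym; trans; cong; cong₂; subst; subst₂; module ≡-Reasoning)

divMod-unique : ∀ {N x y p q} → x < N → y < N → x + p * N ≡ y + q * N → x ≡ y × p ≡ q
divMod-unique {N} {x} {y} {p} {q} x<N y<N eq =
  x≡y , *-cancelʳ-≡ p q N (+-cancelˡ-≡ x _ _ (trans eq (cong (_+ q * N) (sym x≡y))))
  where
  instance
    N≢0 : NonZero N
    N≢0 = >-nonZero (≤-<-trans z≤n x<N)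
  x≡y : x ≡ y
  x≡y = begin
    x              ≡⟨ sym (m<n⇒m%n≡m x<N) ⟩
    x % N          ≡⟨ sym ([m+kn]%n≡m%n x p N) ⟩
    (x + p * N) % N ≡⟨ cong (_% N) eq ⟩
    (y + q * N) % N ≡⟨ [m+kn]%n≡m%n y q N ⟩
    y % N          ≡⟨ m<n⇒m%n≡m y<N ⟩
    y              ∎
    where open ≡-Reasoning

divMod-2 : ∀ {b q} → b ≤ 1 → (b + q * 2) % 2 ≡ b × (b + q * 2) / 2 ≡ q
divMod-2 {b} {q} b≤1 = divMod-unique (m%n<n (b + q * 2) 2) (s≤s b≤1) (sym (m≡m%n+[m/n]*n (b + q * 2) 2))

bit≤1 : ∀ a i → bit a i ≤ 1
bit≤1 a zero    = s≤s⁻¹ (m%n<n a 2)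
bit≤1 a (suc i) = bit≤1 (a / 2) i

fromBits : ℕ → (ℕ → ℕ) → ℕ
fromBits zero    d = 0
fromBits (suc n) d = d 0 + fromBits n (d ∘ suc) * 2

fromBits-cong : ∀ n {d d′ : ℕ → ℕ} → (∀ {i} → i < n → d i ≡ d′ i) → fromBits n d ≡ fromBits n d′
fromBits-cong zero    eq = refl
fromBits-cong (suc n) eq = cong₂ (λ x y → x + y * 2) (eq z<s) (fromBits-cong n (eq ∘ s<s))

fromBits-+ : ∀ n (d d′ : ℕ → ℕ) → fromBits n (λ i → d i + d′ i) ≡ fromBits n d + fromBits n d′
fromBits-+ zero    d d′ = refl
fromBits-+ (suc n) d d′ = trans (cong (λ y → d 0 + d′ 0 + y * 2) (fromBits-+ n (d ∘ suc) (d′ ∘ suc)))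
                                (interchange (d 0) (d′ 0) (fromBits n (d ∘ suc)) (fromBits n (d′ ∘ suc)))
  where
  interchange : ∀ x x′ y y′ → x + x′ + (y + y′) * 2 ≡ (x + y * 2) + (x′ + y′ * 2)
  interchange = solve-∀

fromBits-++ : ∀ m n (d : ℕ → ℕ) → fromBits (m + n) d ≡ fromBits m d + fromBits n (λ i → d (m + i)) * 2 ^ m
fromBits-++ zero    n d = sym (*-identityʳ (fromBits n d))
fromBits-++ (suc m) n d = trans (cong (λ y → d 0 + y * 2) (fromBits-++ m n (d ∘ suc)))
                                (reassoc (d 0) (fromBits m (d ∘ suc)) (fromBits n (λ i → d (suc m + i))) (2 ^ m))
  where
  reassoc : ∀ x y z p → x + (y + z * p) * 2 ≡ (x + y * 2) + z * (2 * p)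
  reassoc = solve-∀

fromBits-< : ∀ n {d : ℕ → ℕ} → (∀ i → d i ≤ 1) → fromBits n d < 2 ^ n
fromBits-< zero    d≤1 = z<s
fromBits-< (suc n) {d} d≤1 = begin-strict
  d 0 + F * 2   <⟨ +-monoˡ-< (F * 2) (s≤s (d≤1 0)) ⟩
  2 + F * 2     ≡⟨⟩
  suc F * 2     ≤⟨ *-monoˡ-≤ 2 (fromBits-< n (d≤1 ∘ suc)) ⟩
  2 ^ n * 2     ≡⟨ *-comm (2 ^ n) 2 ⟩
  2 ^ suc n     ∎
  where
  open ≤-Reasoning
  F : ℕ
  F = fromBits n (d ∘ suc)

fromBits-bit : ∀ n {a} → a < 2 ^ n → fromBits n (bit a) ≡ a
fromBits-bit zero    {zero} _ = refl
fromBits-bit zero    {suc a} (s≤s ())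
fromBits-bit (suc n) {a} a<2^[1+n] = begin
  a % 2 + fromBits n (bit (a / 2)) * 2 ≡⟨ cong (λ y → a % 2 + y * 2) (fromBits-bit n a/2<2^n) ⟩
  a % 2 + (a / 2) * 2                  ≡⟨ sym (m≡m%n+[m/n]*n a 2) ⟩
  a                                    ∎
  where
  open ≡-Reasoning
  a/2<2^n : a / 2 < 2 ^ n
  a/2<2^n = m<n*o⇒m/o<n (subst (a <_) (*-comm 2 (2 ^ n)) a<2^[1+n])

bit-fromBits : ∀ n {d : ℕ → ℕ} → (∀ i → d i ≤ 1) → ∀ {i} → i < n → bit (fromBits n d) i ≡ d i
bit-fromBits (suc n) {d} d≤1 {zero}  _         = proj₁ (divMod-2 {q = fromBits n (d ∘ suc)} (d≤1 0))
bit-fromBits (suc n) {d} d≤1 {suc i} (s<s i<n) =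
  trans (cong (λ y → bit y i) (proj₂ (divMod-2 {q = fromBits n (d ∘ suc)} (d≤1 0))))
        (bit-fromBits n (d≤1 ∘ suc) i<n)

fromBits-carry : ∀ n (x z c : ℕ → ℕ) → (∀ {i} → i < n → x i + c i ≡ z i + c (suc i) * 2) →
                 fromBits n x + c 0 ≡ fromBits n z + c n * 2 ^ n
fromBits-carry zero    x z c _    = sym (*-identityʳ (c 0))
fromBits-carry (suc n) x z c step = begin
  x 0 + X * 2 + c 0                 ≡⟨ swap (x 0) (X * 2) (c 0) ⟩
  x 0 + c 0 + X * 2                 ≡⟨ cong (_+ X * 2) (step z<s) ⟩
  z 0 + c 1 * 2 + X * 2             ≡⟨ regroup (z 0) (c 1) X ⟩
  z 0 + (X + c 1) * 2               ≡⟨ cong (λ y → z 0 + y * 2) (fromBits-carry n (x ∘ suc) (z ∘ suc) (c ∘ suc) (step ∘ s<s)) ⟩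
  z 0 + (Z + c (suc n) * 2 ^ n) * 2 ≡⟨ distribute (z 0) Z (c (suc n)) (2 ^ n) ⟩
  z 0 + Z * 2 + c (suc n) * (2 * 2 ^ n) ∎
  where
  open ≡-Reasoning
  X Z : ℕ
  X = fromBits n (x ∘ suc)
  Z = fromBits n (z ∘ suc)
  swap : ∀ a b c → a + b + c ≡ a + c + b
  swap = solve-∀
  regroup : ∀ a b c → a + b * 2 + c * 2 ≡ a + (c + b) * 2
  regroup = solve-∀
  distribute : ∀ a b c p → a + (b + c * p) * 2 ≡ a + b * 2 + c * (2 * p)
  distribute = solve-∀

carry : (ℕ → ℕ) → ℕ → ℕ → ℕ
carry x e zero    = e
carry x e (suc i) = (x i + carry x e i) / 2

carry-step : ∀ x e i → x i + carry x e i ≡ (x i + carry x e i) % 2 + carry x e (suc i) * 2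
carry-step x e i = m≡m%n+[m/n]*n (x i + carry x e i) 2

carry≤1 : ∀ {x e} → (∀ i → x i ≤ 2) → e ≤ 1 → ∀ i → carry x e i ≤ 1
carry≤1 x≤2 e≤1 zero    = e≤1
carry≤1 x≤2 e≤1 (suc i) = s≤s⁻¹ (m<n*o⇒m/o<n {n = 2} (s≤s (+-mono-≤ (x≤2 i) (carry≤1 x≤2 e≤1 i))))

2^n≡1+[2^n∸1] : ∀ n → 2 ^ n ≡ suc (2 ^ n ∸ 1)
2^n≡1+[2^n∸1] n = sym (suc-pred (2 ^ n) {{m^n≢0 2 n}})

rotate : (n : ℕ) → .{{NonZero n}} → ℕ → (ℕ → ℕ) → ℕ → ℕ
rotate n ρ d i = d ((i + (n ∸ ρ)) % n)

fromBits-rotate : ∀ n ρ (d : ℕ → ℕ) .{{_ : NonZero n}} → ρ ≤ n →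
  fromBits n (rotate n ρ d) ≡ fromBits ρ (λ i → d (n ∸ ρ + i)) + fromBits (n ∸ ρ) d * 2 ^ ρ
fromBits-rotate n ρ d ρ≤n = begin
  fromBits n (rotate n ρ d)       ≡⟨ cong (λ k → fromBits k (rotate n ρ d)) (sym ρ+m≡n) ⟩
  fromBits (ρ + m) (rotate n ρ d) ≡⟨ fromBits-++ ρ m (rotate n ρ d) ⟩
  fromBits ρ (rotate n ρ d) + fromBits m (λ i → rotate n ρ d (ρ + i)) * 2 ^ ρ
                                  ≡⟨ cong₂ (λ u v → u + v * 2 ^ ρ) (fromBits-cong ρ low) (fromBits-cong m high) ⟩
  fromBits ρ (λ i → d (m + i)) + fromBits m d * 2 ^ ρ ∎
  where
  open ≡-Reasoning
  m : ℕ
  m = n ∸ ρ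
  ρ+m≡n : ρ + m ≡ n
  ρ+m≡n = m+[n∸m]≡n ρ≤n
  low : ∀ {i} → i < ρ → rotate n ρ d i ≡ d (m + i)
  low {i} i<ρ = cong d (trans (m<n⇒m%n≡m (subst (i + m <_) ρ+m≡n (+-monoˡ-< m i<ρ))) (+-comm i m))
  high : ∀ {i} → i < m → rotate n ρ d (ρ + i) ≡ d i
  high {i} i<m = cong d (begin
    (ρ + i + m) % n ≡⟨ cong (_% n) (+-assoc ρ i m) ⟩
    (ρ + (i + m)) % n ≡⟨ cong (λ k → (ρ + k) % n) (+-comm i m) ⟩
    (ρ + (m + i)) % n ≡⟨ cong (_% n) (sym (+-assoc ρ m i)) ⟩
    (ρ + m + i) % n ≡⟨ cong (λ k → (k + i) % n) ρ+m≡n ⟩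
    (n + i) % n     ≡⟨ cong (_% n) (+-comm n i) ⟩
    (i + n) % n     ≡⟨ [m+n]%n≡m%n i n ⟩
    i % n           ≡⟨ m<n⇒m%n≡m (≤-trans i<m (m∸n≤m n ρ)) ⟩
    i               ∎)

fromBits*2^ρ≡fromBits-rotate : ∀ n ρ (d : ℕ → ℕ) .{{_ : NonZero n}} → ρ ≤ n →
  fromBits n d * 2 ^ ρ ≡ fromBits n (rotate n ρ d) + fromBits ρ (λ i → d (n ∸ ρ + i)) * (2 ^ n ∸ 1)
fromBits*2^ρ≡fromBits-rotate n ρ d ρ≤n = begin
  fromBits n d * 2 ^ ρ                       ≡⟨ cong (λ k → fromBits k d * 2 ^ ρ) (sym m+ρ≡n) ⟩
  fromBits (m + ρ) d * 2 ^ ρ                 ≡⟨ cong (_* 2 ^ ρ) (fromBits-++ m ρ d) ⟩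
  (L + H * 2 ^ m) * 2 ^ ρ                    ≡⟨ expand L H (2 ^ m) (2 ^ ρ) ⟩
  L * 2 ^ ρ + H * (2 ^ m * 2 ^ ρ)            ≡⟨ cong (λ p → L * 2 ^ ρ + H * p) 2^m*2^ρ≡1+M ⟩
  L * 2 ^ ρ + H * suc (2 ^ n ∸ 1)            ≡⟨ collect L H (2 ^ ρ) (2 ^ n ∸ 1) ⟩
  H + L * 2 ^ ρ + H * (2 ^ n ∸ 1)            ≡⟨ cong (_+ H * (2 ^ n ∸ 1)) (sym (fromBits-rotate n ρ d ρ≤n)) ⟩
  fromBits n (rotate n ρ d) + H * (2 ^ n ∸ 1) ∎
  where
  open ≡-Reasoning
  m L H : ℕ
  m = n ∸ ρ
  L = fromBits m d
  H = fromBits ρ (λ i → d (m + i))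
  m+ρ≡n : m + ρ ≡ n
  m+ρ≡n = m∸n+n≡m ρ≤n
  2^m*2^ρ≡1+M : 2 ^ m * 2 ^ ρ ≡ suc (2 ^ n ∸ 1)
  2^m*2^ρ≡1+M = trans (sym (^-distribˡ-+-* 2 m ρ)) (trans (cong (2 ^_) m+ρ≡n) (2^n≡1+[2^n∸1] n))
  expand : ∀ l h p q → (l + h * p) * q ≡ l * q + h * (p * q)
  expand = solve-∀
  collect : ∀ l h q M → l * q + h * suc M ≡ h + l * q + h * M
  collect = solve-∀

[1+m]^q≡1+k*m : ∀ m q → ∃ λ k → suc m ^ q ≡ suc (k * m)
[1+m]^q≡1+k*m m zero    = 0 , refl
[1+m]^q≡1+k*m m (suc q) with [1+m]^q≡1+k*m m q
... | k , eq = suc k + k * m , trans (cong (suc m *_) eq) (multiply m k)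
  where
  multiply : ∀ m k → suc m * suc (k * m) ≡ suc ((suc k + k * m) * m)
  multiply = solve-∀

2^r≡2^[r%n] : ∀ n r .{{_ : NonZero n}} → ∃ λ v → 2 ^ r ≡ 2 ^ (r % n) + v * (2 ^ n ∸ 1)
2^r≡2^[r%n] n r with [1+m]^q≡1+k*m (2 ^ n ∸ 1) (r / n)
... | k , eq = 2 ^ (r % n) * k , (begin
  2 ^ r                                 ≡⟨ cong (2 ^_) (m≡m%n+[m/n]*n r n) ⟩
  2 ^ (r % n + r / n * n)               ≡⟨ ^-distribˡ-+-* 2 (r % n) (r / n * n) ⟩
  2 ^ (r % n) * 2 ^ (r / n * n)         ≡⟨ cong (λ e → 2 ^ (r % n) * 2 ^ e) (*-comm (r / n) n) ⟩
  2 ^ (r % n) * 2 ^ (n * (r / n))       ≡⟨ cong (2 ^ (r % n) *_) (sym (^-*-assoc 2 n (r / n))) ⟩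
  2 ^ (r % n) * (2 ^ n) ^ (r / n)       ≡⟨ cong (λ p → 2 ^ (r % n) * p ^ (r / n)) (2^n≡1+[2^n∸1] n) ⟩
  2 ^ (r % n) * suc (2 ^ n ∸ 1) ^ (r / n) ≡⟨ cong (2 ^ (r % n) *_) eq ⟩
  2 ^ (r % n) * suc (k * (2 ^ n ∸ 1))   ≡⟨ distribute (2 ^ (r % n)) k (2 ^ n ∸ 1) ⟩
  2 ^ (r % n) + 2 ^ (r % n) * k * (2 ^ n ∸ 1) ∎)
  where
  open ≡-Reasoning
  distribute : ∀ p k M → p * suc (k * M) ≡ p + p * k * M
  distribute = solve-∀

G*a≡a+rotation : ∀ n r a .{{_ : NonZero n}} → a < 2 ^ n →
  ∃ λ t → G r * a ≡ a + fromBits n (rotate n (r % n) (bit a)) + t * (2 ^ n ∸ 1)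
G*a≡a+rotation n r a a<2^n with 2^r≡2^[r%n] n r
... | v , 2^r≡ = H + v * a , (begin
  G r * a                                    ≡⟨ cong (λ p → (p + 1) * a) 2^r≡ ⟩
  (2 ^ ρ + v * M + 1) * a                    ≡⟨ expand (2 ^ ρ) v M a ⟩
  a + a * 2 ^ ρ + v * a * M                  ≡⟨ cong (λ y → a + y * 2 ^ ρ + v * a * M) (sym (fromBits-bit n a<2^n)) ⟩
  a + fromBits n (bit a) * 2 ^ ρ + v * a * M ≡⟨ cong (λ y → a + y + v * a * M) (fromBits*2^ρ≡fromBits-rotate n ρ (bit a) ρ≤n) ⟩
  a + (b + H * M) + v * a * M                ≡⟨ collect a b H (v * a) M ⟩
  a + b + (H + v * a) * M                    ∎)
  where
  open ≡-Reasoning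
  ρ M b H : ℕ
  ρ = r % n
  M = 2 ^ n ∸ 1
  b = fromBits n (rotate n ρ (bit a))
  H = fromBits ρ (λ i → bit a (n ∸ ρ + i))
  ρ≤n : ρ ≤ n
  ρ≤n = <⇒≤ (m%n<n r n)
  expand : ∀ p v M a → (p + v * M + 1) * a ≡ a + a * p + v * a * M
  expand = solve-∀
  collect : ∀ a b h u M → a + (b + h * M) + u * M ≡ a + b + (h + u) * M
  collect = solve-∀

∸-divisible⇒%≡ : ∀ {m x y} .{{_ : NonZero m}} → x ≤ y → m ∣ y ∸ x → x % m ≡ y % m
∸-divisible⇒%≡ {m} {x} {y} x≤y (divides k y∸x≡k*m) = begin
  x % m             ≡⟨ sym ([m+kn]%n≡m%n x k m) ⟩
  (x + k * m) % m   ≡⟨ cong (λ z → (x + z) % m) (sym y∸x≡k*m) ⟩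
  (x + (y ∸ x)) % m ≡⟨ cong (_% m) (m+[n∸m]≡n x≤y) ⟩
  y % m             ∎
  where open ≡-Reasoning

≡[mod]⇒%≡ : ∀ {m x y} .{{_ : NonZero m}} → x ≡ y [mod m ] → x % m ≡ y % m
≡[mod]⇒%≡ {m} {x} {y} m∣x-y with ≤-total x y
... | inj₁ x≤y = ∸-divisible⇒%≡ x≤y (subst (m ∣_) (∣x-y∣ x≤y) m∣x-y)
  where
  ∣x-y∣ : x ≤ y → ℤ.∣ ℤ.+ x ℤ.- ℤ.+ y ∣ ≡ y ∸ x
  ∣x-y∣ x≤y = trans (cong ℤ.∣_∣ (m-n≡m⊖n x y)) (∣⊖∣-≤ x≤y)
... | inj₂ y≤x = sym (∸-divisible⇒%≡ y≤x (subst (m ∣_) ∣x-y∣ m∣x-y))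
  where
  ∣x-y∣ : ℤ.∣ ℤ.+ x ℤ.- ℤ.+ y ∣ ≡ x ∸ y
  ∣x-y∣ = trans (cong ℤ.∣_∣ (m-n≡m⊖n x y)) (trans (∣m⊖n∣≡∣n⊖m∣ x y) (∣⊖∣-≤ y≤x))

≡[mod]-+* : ∀ m x k → x ≡ x + k * m [mod m ]
≡[mod]-+* m x k = subst (m ∣_) (sym ∣x-[x+k*m]∣) (divides k refl)
  where
  ∣x-[x+k*m]∣ : ℤ.∣ ℤ.+ x ℤ.- ℤ.+ (x + k * m) ∣ ≡ k * m
  ∣x-[x+k*m]∣ = trans (cong ℤ.∣_∣ (m-n≡m⊖n x (x + k * m)))
                      (trans (∣⊖∣-≤ (m≤m+n x (k * m))) (m+n∸m≡n x (k * m)))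

≡[mod]⇒endAround : ∀ {M s y t} .{{_ : NonZero M}} → s < M → y < 2 * M → s ≡ y + t * M [mod M ] →
  ∃ λ e → e ≤ 1 × y ≡ s + e * M
≡[mod]⇒endAround {M} {s} {y} {t} s<M y<2M s≡y = y / M , s≤s⁻¹ (m<n*o⇒m/o<n y<2M) , (begin
  y                 ≡⟨ m≡m%n+[m/n]*n y M ⟩
  y % M + y / M * M ≡⟨ cong (_+ y / M * M) y%M≡s ⟩
  s + y / M * M     ∎)
  where
  open ≡-Reasoning
  y%M≡s : y % M ≡ s
  y%M≡s = trans (sym ([m+kn]%n≡m%n y t M)) (trans (sym (≡[mod]⇒%≡ s≡y)) (m<n⇒m%n≡m s<M))

endAround⇒≡[mod] : ∀ {M s y t e} → y ≡ s + e * M → s ≡ y + t * M [mod M ]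
endAround⇒≡[mod] {M} {s} {y} {t} {e} refl = subst (λ z → s ≡ z [mod M ]) (regroup s e t M) (≡[mod]-+* M s (e + t))
  where
  regroup : ∀ s e t M → s + (e + t) * M ≡ s + e * M + t * M
  regroup = solve-∀

endAround⇔ : ∀ n {y s e} → y ≡ s + e * (2 ^ n ∸ 1) ⇔ y + e ≡ s + e * 2 ^ n
endAround⇔ n {y} {s} {e} = mk⇔ (λ eq → trans (cong (_+ e) eq) shift)
                               (λ eq → +-cancelʳ-≡ e y (s + e * M) (trans eq (sym shift)))
  where
  M : ℕ
  M = 2 ^ n ∸ 1
  shift : s + e * M + e ≡ s + e * 2 ^ n
  shift = trans (regroup s e M) (cong (λ p → s + e * p) (sym (2^n≡1+[2^n∸1] n)))
    where
    regroup : ∀ s e M → s + e * M + e ≡ s + e * suc M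
    regroup = solve-∀

predMod : ∀ {n} → ℕ → Fin (suc n)
predMod {n} t = (t + n) mod suc n

predMod-toℕ : ∀ {n} (i : Fin (suc n)) → predMod (toℕ i) ≡ subMod (suc n) i 1
predMod-toℕ {zero}  zero = refl
predMod-toℕ {suc n} i    = refl

toℕ-predMod-zero : ∀ n → toℕ (predMod {n} 0) ≡ n
toℕ-predMod-zero n = trans (toℕ-fromℕ< _) (m<n⇒m%n≡m (n<1+n n))

toℕ-predMod-suc : ∀ {n t} → t < suc n → toℕ (predMod {n} (suc t)) ≡ t
toℕ-predMod-suc {n} {t} t<1+n = begin
  toℕ (predMod (suc t))  ≡⟨ toℕ-fromℕ< _ ⟩
  (suc t + n) % suc n    ≡⟨ cong (_% suc n) (sym (+-suc t n)) ⟩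
  (t + suc n) % suc n    ≡⟨ [m+n]%n≡m%n t (suc n) ⟩
  t % suc n              ≡⟨ m<n⇒m%n≡m t<1+n ⟩
  t                      ∎
  where open ≡-Reasoning

CyclicCarries : ∀ n → (ℕ → ℕ) → ℕ → (Fin (suc n) → Fin 2) → Set
CyclicCarries n x s c = ∀ i → x (toℕ i) + toℕ (c (predMod (toℕ i))) ≡ bit s (toℕ i) + toℕ (c i) * 2

endAround⇒cyclicCarries : ∀ n {x s e} → (∀ i → x i ≤ 2) → s < 2 ^ suc n → e ≤ 1 →
  fromBits (suc n) x + e ≡ s + e * 2 ^ suc n → ∃ (CyclicCarries n x s)
endAround⇒cyclicCarries n {x} {s} {e} x≤2 s<2^N e≤1 eq = c , cyclic
  where
  k z : ℕ → ℕ
  k = carry x e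
  z t = (x t + k t) % 2
  z≤1 : ∀ t → z t ≤ 1
  z≤1 t = s≤s⁻¹ (m%n<n (x t + k t) 2)
  z≡s×k≡e : fromBits (suc n) z ≡ s × k (suc n) ≡ e
  z≡s×k≡e = divMod-unique (fromBits-< (suc n) z≤1) s<2^N
              (trans (sym (fromBits-carry (suc n) x z k (λ {t} _ → carry-step x e t))) eq)
  c : Fin (suc n) → Fin 2
  c i = fromℕ< (s≤s (carry≤1 x≤2 e≤1 (suc (toℕ i))))
  toℕ-c : ∀ i → toℕ (c i) ≡ k (suc (toℕ i))
  toℕ-c i = toℕ-fromℕ< _
  c-pred : ∀ i → toℕ (c (predMod (toℕ i))) ≡ k (toℕ i)
  c-pred zero    = trans (toℕ-c _) (trans (cong (k ∘ suc) (toℕ-predMod-zero n)) (proj₂ z≡s×k≡e))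
  c-pred (suc j) = trans (toℕ-c _) (cong (k ∘ suc) (toℕ-predMod-suc (m<n⇒m<1+n (toℕ<n j))))
  cyclic : CyclicCarries n x s c
  cyclic i = begin
    x t + toℕ (c (predMod t)) ≡⟨ cong (x t +_) (c-pred i) ⟩
    x t + k t                 ≡⟨ carry-step x e t ⟩
    z t + k (suc t) * 2       ≡⟨ cong₂ (λ u v → u + v * 2) s-bit (sym (toℕ-c i)) ⟩
    bit s t + toℕ (c i) * 2   ∎
    where
    open ≡-Reasoning
    t : ℕ
    t = toℕ i
    s-bit : z t ≡ bit s t
    s-bit = trans (sym (bit-fromBits (suc n) z≤1 (toℕ<n i)))
                  (cong (λ y → bit y t) (proj₁ z≡s×k≡e))

cyclicCarries⇒endAround : ∀ n {x s} (c : Fin (suc n) → Fin 2) → s < 2 ^ suc n → CyclicCarries n x s c →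
  ∃ λ e → e ≤ 1 × fromBits (suc n) x + e ≡ s + e * 2 ^ suc n
cyclicCarries⇒endAround n {x} {s} c s<2^N cyclic = w 0 , s≤s⁻¹ (toℕ<n (c (predMod 0))) , (begin
  fromBits (suc n) x + w 0                  ≡⟨ fromBits-carry (suc n) x (bit s) w chain ⟩
  fromBits (suc n) (bit s) + w (suc n) * 2 ^ suc n
      ≡⟨ cong₂ (λ u v → u + v * 2 ^ suc n) (fromBits-bit (suc n) s<2^N) w-wraps ⟩
  s + w 0 * 2 ^ suc n                       ∎)
  where
  open ≡-Reasoning
  w : ℕ → ℕ
  w t = toℕ (c (predMod t))
  w-wraps : w (suc n) ≡ w 0
  w-wraps = cong (toℕ ∘ c) (toℕ-injective (trans (toℕ-predMod-suc (n<1+n n)) (sym (toℕ-predMod-zero n))))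
  chain-at : ∀ i → x (toℕ i) + w (toℕ i) ≡ bit s (toℕ i) + w (suc (toℕ i)) * 2
  chain-at i = subst (λ j → x (toℕ i) + w (toℕ i) ≡ bit s (toℕ i) + toℕ (c j) * 2)
                     (sym (toℕ-injective (toℕ-predMod-suc (toℕ<n i)))) (cyclic i)
  chain : ∀ {t} → t < suc n → x t + w t ≡ bit s t + w (suc t) * 2
  chain t<N = subst (λ t → x t + w t ≡ bit s t + w (suc t) * 2) (toℕ-fromℕ< t<N) (chain-at (fromℕ< t<N))

carryEq-ℤ⇔ℕ : ∀ q w p v u →
  (ℤ.+ 2 ℤ.* ℤ.+ q ℤ.- ℤ.+ w ℤ.+ ℤ.+ p ≡ ℤ.+ v ℤ.+ ℤ.+ u) ⇔ (u + v + w ≡ p + q * 2)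
carryEq-ℤ⇔ℕ q w p v u = mk⇔
  (λ eq → +-injective (begin
    ℤ.+ (u + v + w)                  ≡⟨ lift₃ u v w ⟩
    U ℤ.+ V ℤ.+ W                    ≡⟨ swap U V W ⟩
    V ℤ.+ U ℤ.+ W                    ≡⟨ cong (ℤ._+ W) (sym eq) ⟩
    ℤ.+ 2 ℤ.* Q ℤ.- W ℤ.+ P ℤ.+ W    ≡⟨ cancel Q W P ⟩
    P ℤ.+ Q ℤ.* ℤ.+ 2                ≡⟨ sym (lift₂ p q) ⟩
    ℤ.+ (p + q * 2)                  ∎))
  (λ eq → begin
    ℤ.+ 2 ℤ.* Q ℤ.- W ℤ.+ P          ≡⟨ uncancel Q W P ⟩
    P ℤ.+ Q ℤ.* ℤ.+ 2 ℤ.- W          ≡⟨ cong (ℤ._- W) (sym (lift₂ p q)) ⟩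
    ℤ.+ (p + q * 2) ℤ.- W            ≡⟨ cong (λ y → ℤ.+ y ℤ.- W) (sym eq) ⟩
    ℤ.+ (u + v + w) ℤ.- W            ≡⟨ cong (ℤ._- W) (lift₃ u v w) ⟩
    U ℤ.+ V ℤ.+ W ℤ.- W              ≡⟨ unswap U V W ⟩
    V ℤ.+ U                          ∎)
  where
  open ≡-Reasoning
  Q W P V U : ℤ.ℤ
  Q = ℤ.+ q
  W = ℤ.+ w
  P = ℤ.+ p
  V = ℤ.+ v
  U = ℤ.+ u
  lift₃ : ∀ a b c → ℤ.+ (a + b + c) ≡ ℤ.+ a ℤ.+ ℤ.+ b ℤ.+ ℤ.+ c
  lift₃ a b c = trans (pos-+ (a + b) c) (cong (ℤ._+ ℤ.+ c) (pos-+ a b))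
  lift₂ : ∀ a b → ℤ.+ (a + b * 2) ≡ ℤ.+ a ℤ.+ ℤ.+ b ℤ.* ℤ.+ 2
  lift₂ a b = trans (pos-+ a (b * 2)) (cong (ℤ._+_ (ℤ.+ a)) (pos-* b 2))
  swap : ∀ a b c → a ℤ.+ b ℤ.+ c ≡ b ℤ.+ a ℤ.+ c
  swap = ℤsolve-∀
  cancel : ∀ q w p → ℤ.+ 2 ℤ.* q ℤ.- w ℤ.+ p ℤ.+ w ≡ p ℤ.+ q ℤ.* ℤ.+ 2
  cancel = ℤsolve-∀
  uncancel : ∀ q w p → ℤ.+ 2 ℤ.* q ℤ.- w ℤ.+ p ≡ p ℤ.+ q ℤ.* ℤ.+ 2 ℤ.- w
  uncancel = ℤsolve-∀
  unswap : ∀ a b c → a ℤ.+ b ℤ.+ c ℤ.- c ≡ b ℤ.+ a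
  unswap = ℤsolve-∀

CarryEq⇔CyclicCarries : ∀ n r a s (c : Fin (suc n) → Fin 2) →
  CarryEq (suc n) r a s c ⇔ CyclicCarries n (λ t → bit a t + rotate (suc n) (r % suc n) (bit a) t) s c
CarryEq⇔CyclicCarries n r a s c = mk⇔
  (λ ce i → subst₂ (P i) (rotated-index i) (cong (toℕ ∘ c) (sym (predMod-toℕ i)))
                   (Equivalence.to (at i) (ce i)))
  (λ cc i → Equivalence.from (at i)
              (subst₂ (P i) (sym (rotated-index i)) (cong (toℕ ∘ c) (predMod-toℕ i)) (cc i)))
  where
  v w : Fin (suc n) → ℕ
  v i = bit a (toℕ (subMod (suc n) i r))
  w i = toℕ (c (subMod (suc n) i 1))
  P : Fin (suc n) → ℕ → ℕ → Set
  P i v w = bit a (toℕ i) + v + w ≡ bit s (toℕ i) + toℕ (c i) * 2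
  at : ∀ i → (ℤ.+ 2 ℤ.* ℤ.+ toℕ (c i) ℤ.- ℤ.+ w i ℤ.+ ℤ.+ bit s (toℕ i) ≡ ℤ.+ v i ℤ.+ ℤ.+ bit a (toℕ i))
             ⇔ P i (v i) (w i)
  at i = carryEq-ℤ⇔ℕ (toℕ (c i)) (w i) (bit s (toℕ i)) (v i) (bit a (toℕ i))
  rotated-index : ∀ i → v i ≡ rotate (suc n) (r % suc n) (bit a) (toℕ i)
  rotated-index i = cong (bit a) (toℕ-fromℕ< (m%n<n (toℕ i + (suc n ∸ r % suc n)) (suc n)))

2x-y-injective : ∀ (x y x′ y′ : Fin 2) →
  ℤ.+ 2 ℤ.* ℤ.+ toℕ x ℤ.- ℤ.+ toℕ y ≡ ℤ.+ 2 ℤ.* ℤ.+ toℕ x′ ℤ.- ℤ.+ toℕ y′ → x ≡ x′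
2x-y-injective zero       _          zero       _          _ = refl
2x-y-injective (suc zero) _          (suc zero) _          _ = refl
2x-y-injective zero       zero       (suc zero) zero       ()
2x-y-injective zero       zero       (suc zero) (suc zero) ()
2x-y-injective zero       (suc zero) (suc zero) zero       ()
2x-y-injective zero       (suc zero) (suc zero) (suc zero) ()
2x-y-injective (suc zero) zero       zero       zero       ()
2x-y-injective (suc zero) zero       zero       (suc zero) ()
2x-y-injective (suc zero) (suc zero) zero       zero       ()
2x-y-injective (suc zero) (suc zero) zero       (suc zero) ()

CarryEq-unique : ∀ n r a s .{{_ : NonZero n}} (c c′ : Fin n → Fin 2) →
  CarryEq n r a s c → CarryEq n r a s c′ → ∀ i → c i ≡ c′ i
CarryEq-unique n r a s c c′ ce ce′ i =
  2x-y-injective (c i) (c (subMod n i 1)) (c′ i) (c′ (subMod n i 1))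
                 (∙-cancelʳ (ℤ.+ bit s (toℕ i)) _ _ (trans (ce i) (sym (ce′ i))))

1≤x≤N∸2⇒x<N∸1 : ∀ N {x} → 1 ≤ x → x ≤ N ∸ 2 → x < N ∸ 1
1≤x≤N∸2⇒x<N∸1 (suc (suc N)) _       x≤N = s≤s x≤N
1≤x≤N∸2⇒x<N∸1 zero          (s≤s _) ()
1≤x≤N∸2⇒x<N∸1 (suc zero)    (s≤s _) ()

module _ (n r : ℕ) {a s : ℕ} (a<M : a < 2 ^ suc n ∸ 1) (s<M : s < 2 ^ suc n ∸ 1) where

  private
    N M : ℕ
    N = suc n
    M = 2 ^ N ∸ 1
    instance
      M≢0 : NonZero M
      M≢0 = >-nonZero (≤-<-trans z≤n a<M)
    rot x : ℕ → ℕ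
    rot = rotate N (r % N) (bit a)
    x t = bit a t + rot t
    b : ℕ
    b = fromBits N rot
    rot≤1 : ∀ t → rot t ≤ 1
    rot≤1 t = bit≤1 a ((t + (N ∸ r % N)) % N)
    <M⇒<2^N : ∀ {y} → y < M → y < 2 ^ N
    <M⇒<2^N {y} y<M = subst (y <_) (sym (2^n≡1+[2^n∸1] N)) (m<n⇒m<1+n y<M)
    fromBits-x : fromBits N x ≡ a + b
    fromBits-x = trans (fromBits-+ N (bit a) rot) (cong (_+ b) (fromBits-bit N (<M⇒<2^N a<M)))
    a+b<2M : a + b < 2 * M
    a+b<2M = subst (a + b <_) (cong (M +_) (sym (+-identityʳ M)))
               (+-mono-<-≤ a<M (s≤s⁻¹ (subst (b <_) (2^n≡1+[2^n∸1] N) (fromBits-< N rot≤1))))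
    G≡ : ∃ λ t → G r * a ≡ a + b + t * M
    G≡ = G*a≡a+rotation N r a (<M⇒<2^N a<M)

  congruence⇒CarryEq : s ≡ G r * a [mod M ] → ∃ (CarryEq N r a s)
  congruence⇒CarryEq s≡Ga
    with ≡[mod]⇒endAround {t = proj₁ G≡} s<M a+b<2M (subst (λ z → s ≡ z [mod M ]) (proj₂ G≡) s≡Ga)
  ... | e , e≤1 , a+b≡
    with endAround⇒cyclicCarries n {x} (λ t → +-mono-≤ (bit≤1 a t) (rot≤1 t)) (<M⇒<2^N s<M) e≤1
           (Equivalence.to (endAround⇔ N {e = e}) (trans fromBits-x a+b≡))
  ... | c , cyclic = c , Equivalence.from (CarryEq⇔CyclicCarries n r a s c) cyclic

  CarryEq⇒congruence : ∃ (CarryEq N r a s) → s ≡ G r * a [mod M ]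
  CarryEq⇒congruence (c , ce)
    with cyclicCarries⇒endAround n {x} c (<M⇒<2^N s<M) (Equivalence.to (CarryEq⇔CyclicCarries n r a s c) ce)
  ... | e , _ , endAround =
    subst (λ z → s ≡ z [mod M ]) (sym (proj₂ G≡))
      (endAround⇒≡[mod] {t = proj₁ G≡} {e = e}
        (trans (sym fromBits-x) (Equivalence.from (endAround⇔ N {e = e}) endAround)))

theorem2 : (n r : ℕ) → .{{_ : NonZero n}} → .{{_ : NonZero r}} →
    (a s : ℕ) → 1 ≤ a → a ≤ 2 ^ n ∸ 2 → 1 ≤ s → s ≤ 2 ^ n ∸ 2 →
    ((s ≡ G r * a [mod (2 ^ n ∸ 1) ] → ∃ (λ (c : Fin n → Fin 2) → CarryEq n r a s c))
      × ((∃ λ (c : Fin n → Fin 2) → CarryEq n r a s c) → s ≡ G r * a [mod (2 ^ n ∸ 1) ]))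
    × (∀ (c c′ : Fin n → Fin 2) → CarryEq n r a s c → CarryEq n r a s c′ → ∀ i → c i ≡ c′ i)
theorem2 zero    r a s 1≤a a≤ _ _ = ⊥-elim (n≮0 (1≤x≤N∸2⇒x<N∸1 1 1≤a a≤))
theorem2 (suc n) r a s 1≤a a≤ 1≤s s≤ =
  (congruence⇒CarryEq n r a<M s<M , CarryEq⇒congruence n r a<M s<M) , CarryEq-unique (suc n) r a s
  where
  a<M : a < 2 ^ suc n ∸ 1
  a<M = 1≤x≤N∸2⇒x<N∸1 (2 ^ suc n) 1≤a a≤
  s<M : s < 2 ^ suc n ∸ 1
  s<M = 1≤x≤N∸2⇒x<N∸1 (2 ^ suc n) 1≤s s≤
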